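{- There is an absolute constant $c>0$ such that the following holds. Let $d\in\mathbb N$ and let $G$ be a graph with VC-dimension at least $d$. Then $G$ contains an induced subgraph $H$ with at most $2d$ vertices and $\mathrm{pmw}_2(H)\ge c\cdot d$.
   Context: Graphs are finite, simple, undirected. The VC-dimension of $G$ is the maximum size of a set $A\subseteq V(G)$ with $\{N(v)\cap A:v\in V(G)\}=2^A$. For a partition $\mathcal P$ of $V(H)$ and $X\subseteq V(H)$, $X/\mathcal P$ is the set of parts intersecting $X$. A $\mathcal P$-flip of $H$ is obtained by choosing some pairs $(X,Y)$ of parts of $\mathcal P$ (possibly $X=Y$) and complementing the adjacency between all pairs of distinct vertices $x\in X,y\in Y$. $\mathrm{dist}_{\mathcal P}(x,y)=\max\mathrm{dist}_{H'}(x,y)$ over all $\mathcal P$-flips $H'$ of $H$; $\mathrm{Ball}^r_{\mathcal P}(v)=\{x:\mathrm{dist}_{\mathcal P}(x,v)\le r\}$. $\mathrm{pmw}_r(H)$ is the minimum over sequences $\mathcal P_1\preceq\dots\preceq\mathcal P_m$ of partitions of $V(H)$ (each coarser than or equal to the previous) with $\mathcal P_1$ into singletons and $\mathcal P_m=\{V(H)\}$ of $\max_{1\le i<m}\max_{v}|\mathrm{Ball}^r_{\mathcal P_{i+1}}(v)/\mathcal P_i|$. -}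

module Defs where

open import Data.Nat using (ℕ; zero; suc; _≤_; _<_; _∸_)
open import Data.Fin using (Fin)
open import Data.Fin.Subset using (Subset; _∈_; _⊆_; ∣_∣)
open import Data.Bool using (Bool; true; false; _xor_)
open import Data.List using (List; length)
import Data.List.Membership.Propositional as LM
open import Data.Product using (Σ; ∃; _×_; proj₁)
open import Relation.Binary.PropositionalEquality using (_≡_; _≢_)

record Graph (n : ℕ) : Set where
  field
    adj    : Fin n → Fin n → Bool
    sym    : ∀ x y → adj x y ≡ adj y x
    irrefl : ∀ x → adj x x ≡ false
open Graph public

Shattered : ∀ {n} → Graph n → Subset n → Set
Shattered {n} G A =
  ∀ (B : Subset n) → B ⊆ A →
  ∃ λ (v : Fin n) → ∀ (a : Fin n) → a ∈ A →
    (adj G v a ≡ true → a ∈ B) × (a ∈ B → adj G v a ≡ true)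

VCdimAtLeast : ∀ {n} → Graph n → ℕ → Set
VCdimAtLeast {n} G d = Σ (Subset n) λ A → (d ≤ ∣ A ∣) × Shattered G A

induced : ∀ {m n} → Graph n → (Fin m → Fin n) → Graph m
induced G f = record
  { adj    = λ i j → adj G (f i) (f j)
  ; sym    = λ i j → sym G (f i) (f j)
  ; irrefl = λ i → irrefl G (f i) }

-- A partition of Fin n is given by a labelling of vertices with part labels;
-- the parts are the (nonempty) fibres.
Partition : ℕ → Set
Partition n = Fin n → Fin n

Coarser : ∀ {n} → Partition n → Partition n → Set
Coarser p q = ∀ x y → p x ≡ p y → q x ≡ q y

Singletons : ∀ {n} → Partition n → Set
Singletons p = ∀ x y → p x ≡ p y → x ≡ y

Whole : ∀ {n} → Partition n → Set
Whole p = ∀ x y → p x ≡ p y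

-- A flip specification: a symmetric choice of pairs of parts (possibly X = Y).
SymFlip : ℕ → Set
SymFlip n = Σ (Fin n → Fin n → Bool) λ F → ∀ a b → F a b ≡ F b a

FlipEdge : ∀ {n} → Graph n → Partition n → (Fin n → Fin n → Bool) → Fin n → Fin n → Set
FlipEdge G p F x y = (x ≢ y) × ((adj G x y xor F (p x) (p y)) ≡ true)

-- Walk of length at most r from x to y (i.e. dist(x,y) ≤ r).
data WithinDist {n : ℕ} (E : Fin n → Fin n → Set) : ℕ → Fin n → Fin n → Set where
  here : ∀ {r x} → WithinDist E r x x
  step : ∀ {r x z y} → E x z → WithinDist E r z y → WithinDist E (suc r) x y

InBall : ∀ {n} → Graph n → ℕ → Partition n → Fin n → Fin n → Set
InBall {n} G r p v x =
  ∀ (F : SymFlip n) → WithinDist (FlipEdge G p (proj₁ F)) r x v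

BallPartsAtMost : ∀ {n} → Graph n → ℕ → Partition n → Partition n → Fin n → ℕ → Set
BallPartsAtMost {n} G r q p v w =
  Σ (List (Fin n)) λ ls → (length ls ≤ w) ×
    (∀ x → InBall G r q v x → p x LM.∈ ls)

-- pmw_r(G) ≤ w : there is a sequence P_0 ⪯ … ⪯ P_{L-1} (L ≥ 1) with P_0 into
-- singletons, P_{L-1} = {V}, each coarser than the previous, and
-- |Ball^r_{P_{i+1}}(v) / P_i| ≤ w for all i with i+1 < L and all v.
PmwAtMost : ∀ {n} → ℕ → Graph n → ℕ → Set
PmwAtMost {n} r G w =
  Σ ℕ λ L → Σ (ℕ → Partition n) λ P →
    (1 ≤ L) × Singletons (P 0) × Whole (P (L ∸ 1)) ×
    (∀ i → suc i < L → Coarser (P i) (P (suc i))) ×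
    (∀ i → suc i < L → ∀ v → BallPartsAtMost G r (P (suc i)) (P i) v w)

-- Let 2^r ≤ d < 2^(r+1) and index 2^r vertices a_u (u ∈ 𝔽₂^r) of a shattered set. Shattering gives,
-- for each v ∈ 𝔽₂^r, a vertex b_v adjacent to exactly those a_u with u·v = 1; H is induced on the
-- a_u and b_v, so it has at most 2d vertices.
--
-- Given a partition sequence of H, look at the first step P_i ⪯ P_{i+1} at which a part X of
-- P_{i+1} contains nine of the a_u (the case of the b_v is symmetric). Nine vectors contain four
-- independent ones c₁,…,c₄, and by Fourier analysis every syndrome (c_j·y)_j ∈ 𝔽₂⁴ is taken by
-- exactly 2^r/16 vectors y. The syndromes 1100 and 1010 together show every pair of bits, so if
-- b_y and b_v have these syndromes, X contains a vertex with each of the four possible adjacency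
-- patterns towards b_y and b_v; whatever the flip, one of them is a common neighbour. So the 2-ball
-- of b_v contains about 2^r/16 of the b_y, while each part of P_i contains at most eight of them,
-- and the ball meets about 2^r/128 parts of P_i. For d < 256 a single edge of G suffices.

module Submission where

open import Defs hiding (sym)

open import Algebra.Bundles using (CommutativeMonoid; CommutativeRing)
import Algebra.Properties.CommutativeSemigroup as CommutativeSemigroupProperties
open import Data.Bool using (Bool; true; false; _∧_; _xor_; not)
import Data.Bool as Bool
open import Data.Bool.Properties
  using (∧-comm; ∧-distribʳ-xor; xor-identityʳ; xor-inverseˡ; xor-∧-commutativeRing; ⇔→≡)
open import Data.Fin using (Fin; zero; suc; _≟_)
open import Data.Fin.Patterns using (0F; 1F; 2F; 3F)
import Data.Fin as Fin
import Data.Fin.Properties as Fin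
open import Data.Fin.Subset using (Subset; ∣_∣; Nonempty) renaming (_∈_ to _∈ˢ_; _⊆_ to _⊆ˢ_)
open import Data.Fin.Subset.Properties using (nonempty?; Empty-unique; ∣⊥∣≡0)
open import Data.Integer using (ℤ; +_; 0ℤ; 1ℤ; -1ℤ)
import Data.Integer as ℤ
import Data.Integer.Properties as ℤ
import Data.Integer.Tactic.RingSolver as ℤ-Solver
open import Data.List using (List; []; _∷_; _++_; map; length; deduplicate)
import Data.List as List
open import Data.List.Properties using (length-++; length-map; length-deduplicate)
open import Data.List.Membership.Propositional using (_∈_; _∉_; lose)
open import Data.List.Membership.Propositional.Properties
  using (∈-++⁺ˡ; ∈-++⁺ʳ; ∈-map⁺; ∈-map⁻; ∈-lookup; ∈-deduplicate⁺)
import Data.List.Membership.Setoid.Properties as SetoidMembership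
open import Data.List.Relation.Unary.All using (lookup; universal)
import Data.List.Relation.Unary.All.Properties as All
open import Data.List.Relation.Unary.Any using (here; there; any?; satisfied; index)
open import Data.List.Relation.Unary.Any.Properties using (lookup-index)
open import Data.List.Relation.Unary.Unique.Propositional using (Unique; []; _∷_)
import Data.List.Relation.Unary.Unique.Propositional.Properties as Unique
import Data.List.Relation.Unary.Unique.DecPropositional.Properties as UniqueDec
open import Data.Nat using (ℕ; zero; suc; _+_; _*_; _^_; _≤_; _<_; z≤n; s≤s)
import Data.Nat.Properties as ℕ
import Data.Nat.Tactic.RingSolver as ℕ-Solver
open import Data.Product using (Σ; ∃; _×_; _,_; proj₁; proj₂)
open import Data.Sum using (inj₁; inj₂)
open import Data.Vec using (Vec; []; _∷_; zipWith; replicate)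
import Data.Vec as Vec
open import Data.Vec.Properties
  using (∷-injectiveʳ; ≡-dec; lookup-map; length-toList; lookup∘tabulate; []=⇒lookup; lookup⇒[]=)
open import Data.Vec.Relation.Unary.All using (All) renaming ([] to []ᵛ; _∷_ to _∷ᵛ_)
open import Data.Vec.Relation.Unary.All.Properties using (lookup⁺)
import Data.Vec.Membership.Propositional.Properties as VecMembership
open import Function using (_∘_; flip)
open import Function.Bundles using (mk⇔)
open import Function.Definitions using (Injective)
open import Relation.Binary.Definitions using (DecidableEquality)
open import Relation.Binary.PropositionalEquality
  using (_≡_; _≢_; refl; sym; trans; cong; cong₂; subst; subst₂; setoid; module ≡-Reasoning)
open import Relation.Nullary using (Dec; yes; no; ¬_; ¬?; _×-dec_; _⊎-dec_; contradiction)
open import Relation.Nullary.Decidable using (does; dec-true)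
import Relation.Nullary.Decidable as Dec
open import Relation.Unary using (Pred; Decidable)

-- The Boolean cube

Bits : ℕ → Set
Bits = Vec Bool

_≟ᵇ_ : ∀ {r} → DecidableEquality (Bits r)
_≟ᵇ_ = ≡-dec Bool._≟_

cube : ∀ r → List (Bits r)
cube zero    = [] ∷ []
cube (suc r) = map (false ∷_) (cube r) ++ map (true ∷_) (cube r)

∈-cube : ∀ {r} (x : Bits r) → x ∈ cube r
∈-cube []                  = here refl
∈-cube (false ∷ x)         = ∈-++⁺ˡ (∈-map⁺ (false ∷_) (∈-cube x))
∈-cube {suc r} (true ∷ x)  = ∈-++⁺ʳ (map (false ∷_) (cube r)) (∈-map⁺ (true ∷_) (∈-cube x))

length-cube : ∀ r → length (cube r) ≡ 2 ^ r
length-cube zero    = refl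
length-cube (suc r) = begin
  length (map (false ∷_) (cube r) ++ map (true ∷_) (cube r))
    ≡⟨ length-++ (map (false ∷_) (cube r)) ⟩
  length (map (false ∷_) (cube r)) + length (map (true ∷_) (cube r))
    ≡⟨ cong₂ _+_ (length-map _ (cube r)) (length-map _ (cube r)) ⟩
  length (cube r) + length (cube r)
    ≡⟨ cong₂ _+_ (length-cube r) (trans (length-cube r) (sym (ℕ.+-identityʳ _))) ⟩
  2 ^ suc r ∎
  where open ≡-Reasoning

∃? : ∀ {p r} {P : Pred (Bits r) p} → Decidable P → Dec (∃ P)
∃? {r = r} P? = Dec.map′ satisfied (λ (x , Px) → lose (∈-cube x) Px) (any? P? (cube r))

module CubeSum {c ℓ} (M : CommutativeMonoid c ℓ) where

  open CommutativeMonoid M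
    using (Carrier; _≈_; _∙_; ε; ∙-cong; identityˡ; identityʳ; commutativeSemigroup)
    renaming (refl to ≈-refl; sym to ≈-sym; trans to ≈-trans)
  open CommutativeSemigroupProperties commutativeSemigroup using (interchange)

  ∑ : ∀ {r} → (Bits r → Carrier) → Carrier
  ∑ {zero}  f = f []
  ∑ {suc r} f = ∑ (f ∘ (false ∷_)) ∙ ∑ (f ∘ (true ∷_))

  ∑-cong : ∀ {r} {f g : Bits r → Carrier} → (∀ x → f x ≈ g x) → ∑ f ≈ ∑ g
  ∑-cong {zero}  f≈g = f≈g []
  ∑-cong {suc r} f≈g = ∙-cong (∑-cong (f≈g ∘ (false ∷_))) (∑-cong (f≈g ∘ (true ∷_)))

  ∑-distrib : ∀ {r} (f g : Bits r → Carrier) → ∑ (λ x → f x ∙ g x) ≈ ∑ f ∙ ∑ g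
  ∑-distrib {zero}  f g = ≈-refl
  ∑-distrib {suc r} f g = ≈-trans
    (∙-cong (∑-distrib (f ∘ (false ∷_)) (g ∘ (false ∷_))) (∑-distrib (f ∘ (true ∷_)) (g ∘ (true ∷_))))
    (interchange _ _ _ _)

  ∑-hom : ∀ {r} (h : Carrier → Carrier) → (∀ x y → h (x ∙ y) ≈ h x ∙ h y) →
          (f : Bits r → Carrier) → ∑ (h ∘ f) ≈ h (∑ f)
  ∑-hom {zero}  h h-∙ f = ≈-refl
  ∑-hom {suc r} h h-∙ f =
    ≈-trans (∙-cong (∑-hom h h-∙ (f ∘ (false ∷_))) (∑-hom h h-∙ (f ∘ (true ∷_)))) (≈-sym (h-∙ _ _))

  ∑-swap : ∀ {r s} (f : Bits r → Bits s → Carrier) → ∑ (λ x → ∑ (f x)) ≈ ∑ (λ y → ∑ (λ x → f x y))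
  ∑-swap {zero}  f = ≈-refl
  ∑-swap {suc r} f = ≈-trans
    (∙-cong (∑-swap (f ∘ (false ∷_))) (∑-swap (f ∘ (true ∷_))))
    (≈-sym (∑-distrib (λ y → ∑ (λ x → f (false ∷ x) y)) (λ y → ∑ (λ x → f (true ∷ x) y))))

  ∑-ε : ∀ {r} → ∑ {r} (λ _ → ε) ≈ ε
  ∑-ε {zero}  = ≈-refl
  ∑-ε {suc r} = ≈-trans (∙-cong (∑-ε {r}) (∑-ε {r})) (identityˡ ε)

  ∑-point : ∀ {r} (u : Bits r) {f : Bits r → Carrier} → (∀ x → x ≢ u → f x ≈ ε) → ∑ f ≈ f u
  ∑-point []                  f≈ε = ≈-refl
  ∑-point {suc r} (false ∷ u) f≈ε = ≈-trans
    (∙-cong (∑-point u λ x x≢u → f≈ε (false ∷ x) (x≢u ∘ ∷-injectiveʳ))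
            (≈-trans (∑-cong λ x → f≈ε (true ∷ x) λ ()) (∑-ε {r})))
    (identityʳ _)
  ∑-point {suc r} (true ∷ u)  f≈ε = ≈-trans
    (∙-cong (≈-trans (∑-cong λ x → f≈ε (false ∷ x) λ ()) (∑-ε {r}))
            (∑-point u λ x x≢u → f≈ε (true ∷ x) (x≢u ∘ ∷-injectiveʳ)))
    (identityˡ _)

open CubeSum ℕ.+-0-commutativeMonoid

∑-mono : ∀ {r} {f g : Bits r → ℕ} → (∀ x → f x ≤ g x) → ∑ f ≤ ∑ g
∑-mono {zero}  f≤g = f≤g []
∑-mono {suc r} f≤g = ℕ.+-mono-≤ (∑-mono (f≤g ∘ (false ∷_))) (∑-mono (f≤g ∘ (true ∷_)))

term≤∑ : ∀ {r} (f : Bits r → ℕ) x → f x ≤ ∑ f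
term≤∑ f []          = ℕ.≤-refl
term≤∑ f (false ∷ x) = ℕ.≤-trans (term≤∑ (f ∘ (false ∷_)) x) (ℕ.m≤m+n _ _)
term≤∑ f (true ∷ x)  = ℕ.≤-trans (term≤∑ (f ∘ (true ∷_)) x) (ℕ.m≤n+m _ _)

∑-one : ∀ r → ∑ {r} (λ _ → 1) ≡ 2 ^ r
∑-one zero    = refl
∑-one (suc r) = cong₂ _+_ (∑-one r) (trans (∑-one r) (sym (ℕ.+-identityʳ _)))

𝟙 : ∀ {a} {A : Set a} → Dec A → ℕ
𝟙 (yes _) = 1
𝟙 (no _)  = 0

𝟙-yes : ∀ {a} {A : Set a} (a? : Dec A) → A → 𝟙 a? ≡ 1
𝟙-yes (yes _) _  = refl
𝟙-yes (no ¬a) a  = contradiction a ¬a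

𝟙-no : ∀ {a} {A : Set a} (a? : Dec A) → ¬ A → 𝟙 a? ≡ 0
𝟙-no (yes a) ¬a = contradiction a ¬a
𝟙-no (no _)  _  = refl

𝟙≤1 : ∀ {a} {A : Set a} (a? : Dec A) → 𝟙 a? ≤ 1
𝟙≤1 (yes _) = s≤s z≤n
𝟙≤1 (no _)  = z≤n

count : ∀ {p r} {P : Pred (Bits r) p} → Decidable P → ℕ
count P? = ∑ (𝟙 ∘ P?)

count≡0 : ∀ {p r} {P : Pred (Bits r) p} (P? : Decidable P) → (∀ x → ¬ P x) → count P? ≡ 0
count≡0 {r = r} P? ∄P = trans (∑-cong λ x → 𝟙-no (P? x) (∄P x)) (∑-ε {r})

count-split : ∀ {p q r} {P : Pred (Bits r) p} {Q : Pred (Bits r) q} (P? : Decidable P) (Q? : Decidable Q) →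
              count P? ≤ count Q? + count (λ x → P? x ×-dec ¬? (Q? x))
count-split P? Q? =
  ℕ.≤-trans (∑-mono pointwise) (ℕ.≤-reflexive (∑-distrib (𝟙 ∘ Q?) λ x → 𝟙 (P? x ×-dec ¬? (Q? x))))
  where
  pointwise : ∀ x → 𝟙 (P? x) ≤ 𝟙 (Q? x) + 𝟙 (P? x ×-dec ¬? (Q? x))
  pointwise x with P? x | Q? x
  ... | yes _ | yes _ = s≤s z≤n
  ... | yes _ | no _  = ℕ.≤-refl
  ... | no _  | _     = z≤n

count<⇒∃ : ∀ {p q r} {P : Pred (Bits r) p} {Q : Pred (Bits r) q} (P? : Decidable P) (Q? : Decidable Q) →
           count Q? < count P? → ∃ λ x → P x × ¬ Q x
count<⇒∃ P? Q? Q<P with ∃? (λ x → P? x ×-dec ¬? (Q? x))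
... | yes P∖Q = P∖Q
... | no  ∄x  = contradiction (count-split P? Q?) (ℕ.<⇒≱ (begin-strict
  count Q? + count (λ x → P? x ×-dec ¬? (Q? x))  ≡⟨ cong (_+_ (count Q?)) (count≡0 _ (λ x → ∄x ∘ (x ,_))) ⟩
  count Q? + 0                                    ≡⟨ ℕ.+-identityʳ _ ⟩
  count Q?                                        <⟨ Q<P ⟩
  count P?                                        ∎))
  where open ℕ.≤-Reasoning

count-point : ∀ {r} (y : Bits r) → count (y ≟ᵇ_) ≡ 1
count-point y = trans (∑-point y λ x x≢y → 𝟙-no (y ≟ᵇ x) (x≢y ∘ sym)) (𝟙-yes (y ≟ᵇ y) refl)

count-fibre≤1 : ∀ {r m} (g : Bits r → Fin m) → Injective _≡_ _≡_ g → ∀ z → count (λ x → g x ≟ z) ≤ 1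
count-fibre≤1 g g-injective z with ∃? (λ x → g x ≟ z)
... | yes (x₀ , gx₀≡z) = ℕ.≤-trans
  (ℕ.≤-reflexive (∑-point x₀ λ x x≢x₀ → 𝟙-no (g x ≟ z) (x≢x₀ ∘ g-injective ∘ flip trans (sym gx₀≡z))))
  (𝟙≤1 (g x₀ ≟ z))
... | no ∄x = ℕ.≤-trans (ℕ.≤-reflexive (count≡0 _ λ x gx≡z → ∄x (x , gx≡z))) z≤n

count-image≤ : ∀ {j r} (g : Bits j → Bits r) → count (λ x → ∃? λ I → g I ≟ᵇ x) ≤ 2 ^ j
count-image≤ {j} g = begin
  count (λ x → ∃? λ I → g I ≟ᵇ x)    ≤⟨ ∑-mono covered ⟩
  ∑ (λ x → ∑ (λ I → 𝟙 (g I ≟ᵇ x)))  ≡⟨ ∑-swap (λ x I → 𝟙 (g I ≟ᵇ x)) ⟩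
  ∑ (λ I → count (g I ≟ᵇ_))          ≡⟨ ∑-cong (count-point ∘ g) ⟩
  ∑ {j} (λ _ → 1)                    ≡⟨ ∑-one j ⟩
  2 ^ j                              ∎
  where
  open ℕ.≤-Reasoning
  covered : ∀ x → 𝟙 (∃? λ I → g I ≟ᵇ x) ≤ ∑ (λ I → 𝟙 (g I ≟ᵇ x))
  covered x with ∃? (λ I → g I ≟ᵇ x)
  ... | yes (I , gI≡x) = ℕ.≤-trans (ℕ.≤-reflexive (sym (𝟙-yes (g I ≟ᵇ x) gI≡x))) (term≤∑ _ I)
  ... | no _           = z≤n

pigeonhole : ∀ {p r m K} (h : Bits r → Fin m) → (∀ z → count (λ y → h y ≟ z) ≤ K) →
             (zs : List (Fin m)) {P : Pred (Bits r) p} (P? : Decidable P) →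
             (∀ {y} → P y → h y ∈ zs) → count P? ≤ length zs * K
pigeonhole h fibre≤K []       P? into = ℕ.≤-reflexive (count≡0 P? λ y Py → contradiction (into Py) λ ())
pigeonhole {K = K} h fibre≤K (z ∷ zs) {P} P? into = begin
  count P?
    ≤⟨ count-split P? (λ y → h y ≟ z) ⟩
  count (λ y → h y ≟ z) + count (λ y → P? y ×-dec ¬? (h y ≟ z))
    ≤⟨ ℕ.+-mono-≤ (fibre≤K z) (pigeonhole h fibre≤K zs _ into-zs) ⟩
  K + length zs * K ∎
  where
  open ℕ.≤-Reasoning
  into-zs : ∀ {y} → P y × h y ≢ z → h y ∈ zs
  into-zs (Py , hy≢z) with into Py
  ... | here hy≡z   = contradiction hy≡z hy≢z
  ... | there hy∈zs = hy∈zs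

count-preimage≤ : ∀ {r m} (g : Bits r → Fin m) → Injective _≡_ _≡_ g →
                  (zs : List (Fin m)) → count (λ y → any? (g y ≟_) zs) ≤ length zs
count-preimage≤ g g-injective zs = ℕ.≤-trans
  (pigeonhole g (count-fibre≤1 g g-injective) zs _ (λ gy∈zs → gy∈zs))
  (ℕ.≤-reflexive (ℕ.*-identityʳ _))

-- Linear algebra over 𝔽₂

infixl 6 _⊕_
infix  7 _·_

_⊕_ : ∀ {r} → Bits r → Bits r → Bits r
_⊕_ = zipWith _xor_

0ᵇ : ∀ {r} → Bits r
0ᵇ = replicate _ false

_·_ : ∀ {r} → Bits r → Bits r → Bool
[]      · []      = false
(a ∷ u) · (b ∷ x) = (a ∧ b) xor (u · x)

·-comm : ∀ {r} (u x : Bits r) → u · x ≡ x · u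
·-comm []      []      = refl
·-comm (a ∷ u) (b ∷ x) = cong₂ _xor_ (∧-comm a b) (·-comm u x)

·-zeroˡ : ∀ {r} (x : Bits r) → 0ᵇ · x ≡ false
·-zeroˡ []      = refl
·-zeroˡ (_ ∷ x) = ·-zeroˡ x

·-distribʳ-⊕ : ∀ {r} (u v x : Bits r) → (u ⊕ v) · x ≡ u · x xor v · x
·-distribʳ-⊕ []      []      []      = refl
·-distribʳ-⊕ (a ∷ u) (b ∷ v) (c ∷ x) = begin
  ((a xor b) ∧ c) xor (u ⊕ v) · x             ≡⟨ cong₂ _xor_ (∧-distribʳ-xor c a b) (·-distribʳ-⊕ u v x) ⟩
  ((a ∧ c) xor (b ∧ c)) xor (u · x xor v · x)  ≡⟨ xor-interchange (a ∧ c) (b ∧ c) (u · x) (v · x) ⟩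
  ((a ∧ c) xor u · x) xor ((b ∧ c) xor v · x)  ∎
  where
  open ≡-Reasoning
  open CommutativeSemigroupProperties (CommutativeRing.+-commutativeSemigroup xor-∧-commutativeRing)
    renaming (interchange to xor-interchange)

⊕≡0ᵇ⇒≡ : ∀ {r} (u v : Bits r) → u ⊕ v ≡ 0ᵇ → u ≡ v
⊕≡0ᵇ⇒≡ []          []          _ = refl
⊕≡0ᵇ⇒≡ (false ∷ u) (false ∷ v) e = cong (false ∷_) (⊕≡0ᵇ⇒≡ u v (∷-injectiveʳ e))
⊕≡0ᵇ⇒≡ (true ∷ u)  (true ∷ v)  e = cong (true ∷_) (⊕≡0ᵇ⇒≡ u v (∷-injectiveʳ e))
⊕≡0ᵇ⇒≡ (false ∷ u) (true ∷ v)  ()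
⊕≡0ᵇ⇒≡ (true ∷ u)  (false ∷ v) ()

·-separates : ∀ {r} (x y : Bits r) → (∀ c → c · x ≡ c · y) → x ≡ y
·-separates []      []      _       = refl
·-separates (a ∷ x) (b ∷ y) c·x≡c·y = cong₂ _∷_ heads (·-separates x y (c·x≡c·y ∘ (false ∷_)))
  where
  heads : a ≡ b
  heads = begin
    a                      ≡⟨ xor-identityʳ a ⟨
    a xor false            ≡⟨ cong (a xor_) (·-zeroˡ x) ⟨
    (true ∷ 0ᵇ) · (a ∷ x)  ≡⟨ c·x≡c·y (true ∷ 0ᵇ) ⟩
    b xor 0ᵇ · y           ≡⟨ cong (b xor_) (·-zeroˡ y) ⟩
    b xor false            ≡⟨ xor-identityʳ b ⟩
    b                      ∎
    where open ≡-Reasoning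

combination : ∀ {r k} → Vec (Bits r) k → Bits k → Bits r
combination []      []          = 0ᵇ
combination (c ∷ C) (false ∷ I) = combination C I
combination (c ∷ C) (true ∷ I)  = c ⊕ combination C I

combination-0ᵇ : ∀ {r k} (C : Vec (Bits r) k) → combination C 0ᵇ ≡ 0ᵇ
combination-0ᵇ []      = refl
combination-0ᵇ (_ ∷ C) = combination-0ᵇ C

Independent : ∀ {r k} → Vec (Bits r) k → Set
Independent C = ∀ I → combination C I ≡ 0ᵇ → I ≡ 0ᵇ

independent-∷ : ∀ {r k} {c : Bits r} {C : Vec (Bits r) k} → Independent C →
                (∀ I → combination C I ≢ c) → Independent (c ∷ C)
independent-∷ C-independent c∉span (false ∷ I) CI≡0ᵇ  = cong (false ∷_) (C-independent I CI≡0ᵇ)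
independent-∷ C-independent c∉span (true ∷ I)  cCI≡0ᵇ =
  contradiction (sym (⊕≡0ᵇ⇒≡ _ _ cCI≡0ᵇ)) (c∉span I)

module _ {p r} {P : Pred (Bits r) p} (P? : Decidable P) where

  extend-independent : ∀ {k} → 2 ^ k < count P? → (C : Vec (Bits r) k) → Independent C →
                       ∃ λ c → P c × Independent (c ∷ C)
  extend-independent 2^k<#P C C-independent
    with c , Pc , c∉span ← count<⇒∃ P? (λ x → ∃? λ I → combination C I ≟ᵇ x)
                                      (ℕ.≤-<-trans (count-image≤ (combination C)) 2^k<#P) =
    c , Pc , independent-∷ C-independent λ I CI≡c → c∉span (I , CI≡c)

  independent-vectors : ∀ k → 2 ^ k < count P? → ∃ λ (C : Vec (Bits r) (suc k)) → All P C × Independent C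
  independent-vectors zero 1<#P
    with c , Pc , c-independent ← extend-independent 1<#P [] (λ { [] _ → refl }) =
    c ∷ [] , Pc ∷ᵛ []ᵛ , c-independent
  independent-vectors (suc k) 2^k+1<#P
    with C , PC , C-independent ← independent-vectors k
           (ℕ.<-trans (ℕ.^-monoʳ-< 2 (s≤s (s≤s z≤n)) (ℕ.n<1+n k)) 2^k+1<#P)
    with c , Pc , cC-independent ← extend-independent 2^k+1<#P C C-independent =
    c ∷ C , Pc ∷ᵛ PC , cC-independent

-- Fourier analysis on 𝔽₂^r

open CubeSum ℤ.+-0-commutativeMonoid using ()
  renaming (∑ to ∑ℤ; ∑-cong to ∑ℤ-cong; ∑-hom to ∑ℤ-hom; ∑-swap to ∑ℤ-swap; ∑-point to ∑ℤ-point)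

σ : Bool → ℤ
σ false = 1ℤ
σ true  = -1ℤ

σ-xor : ∀ a b → σ (a xor b) ≡ σ a ℤ.* σ b
σ-xor false b     = sym (ℤ.*-identityˡ (σ b))
σ-xor true  false = refl
σ-xor true  true  = refl

∑ℤ-pos : ∀ {r} (f : Bits r → ℕ) → ∑ℤ (λ x → + f x) ≡ + ∑ f
∑ℤ-pos {zero}  f = refl
∑ℤ-pos {suc r} f = cong₂ ℤ._+_ (∑ℤ-pos (f ∘ (false ∷_))) (∑ℤ-pos (f ∘ (true ∷_)))

character-sum-0ᵇ : ∀ r → ∑ℤ {r} (λ x → σ (0ᵇ · x)) ≡ + 2 ^ r
character-sum-0ᵇ r = begin
  ∑ℤ {r} (λ x → σ (0ᵇ · x))  ≡⟨ ∑ℤ-cong {r} (λ x → cong σ (·-zeroˡ x)) ⟩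
  ∑ℤ {r} (λ _ → + 1)         ≡⟨ ∑ℤ-pos {r} (λ _ → 1) ⟩
  + ∑ {r} (λ _ → 1)          ≡⟨ cong +_ (∑-one r) ⟩
  + 2 ^ r                    ∎
  where open ≡-Reasoning

character-sum : ∀ {r} (u : Bits r) → u ≢ 0ᵇ → ∑ℤ (λ x → σ (u · x)) ≡ 0ℤ
character-sum []          u≢0ᵇ = contradiction refl u≢0ᵇ
character-sum (false ∷ u) u≢0ᵇ =
  cong₂ ℤ._+_ (character-sum u (u≢0ᵇ ∘ cong (false ∷_))) (character-sum u (u≢0ᵇ ∘ cong (false ∷_)))
character-sum (true ∷ u)  _    = begin
  S ℤ.+ ∑ℤ (λ x → σ (true xor u · x))
    ≡⟨ cong (ℤ._+_ S) (∑ℤ-cong λ x → σ-xor true (u · x)) ⟩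
  S ℤ.+ ∑ℤ (λ x → -1ℤ ℤ.* σ (u · x))
    ≡⟨ cong (ℤ._+_ S) (∑ℤ-hom (-1ℤ ℤ.*_) (ℤ.*-distribˡ-+ -1ℤ) (σ ∘ (u ·_))) ⟩
  S ℤ.+ -1ℤ ℤ.* S
    ≡⟨ cong (ℤ._+_ S) (ℤ.-1*i≡-i S) ⟩
  S ℤ.- S
    ≡⟨ ℤ.+-inverseʳ S ⟩
  0ℤ ∎
  where
  open ≡-Reasoning
  S : ℤ
  S = ∑ℤ (λ x → σ (u · x))

syndrome : ∀ {r k} → Vec (Bits r) k → Bits r → Bits k
syndrome C x = Vec.map (_· x) C

solutions? : ∀ {r k} (C : Vec (Bits r) k) (τ : Bits k) → Decidable (λ x → syndrome C x ≡ τ)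
solutions? C τ x = syndrome C x ≟ᵇ τ

𝟙-∷ : ∀ {r} a b (u v : Bits r) → 𝟙 ((a ∷ u) ≟ᵇ (b ∷ v)) ≡ 𝟙 (a Bool.≟ b) * 𝟙 (u ≟ᵇ v)
𝟙-∷ a b u v with a Bool.≟ b | u ≟ᵇ v
... | yes _ | yes _ = refl
... | yes _ | no _  = refl
... | no _  | _     = refl

1+σ*σ : ∀ e t → 1ℤ ℤ.+ σ t ℤ.* σ e ≡ + (2 * 𝟙 (e Bool.≟ t))
1+σ*σ false false = refl
1+σ*σ false true  = refl
1+σ*σ true  false = refl
1+σ*σ true  true  = refl

-- ∏ⱼ (1 + σ τⱼ · σ (cⱼ · x)) is 2^k if every cⱼ · x equals τⱼ and 0 otherwise; expand the product.
indicator-expansion : ∀ {r k} (C : Vec (Bits r) k) (τ : Bits k) (x : Bits r) →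
  + (2 ^ k * 𝟙 (syndrome C x ≟ᵇ τ)) ≡ ∑ℤ (λ I → σ (I · τ) ℤ.* σ (combination C I · x))
indicator-expansion []      []      x = sym (trans (ℤ.*-identityˡ _) (cong σ (·-zeroˡ x)))
indicator-expansion {k = suc k} (c ∷ C) (t ∷ τ) x = begin
  + (2 ^ suc k * 𝟙 (syndrome (c ∷ C) x ≟ᵇ (t ∷ τ)))
    ≡⟨ cong (λ n → + (2 ^ suc k * n)) (𝟙-∷ (c · x) t (syndrome C x) τ) ⟩
  + (2 ^ suc k * (𝟙 (c · x Bool.≟ t) * 𝟙 (syndrome C x ≟ᵇ τ)))
    ≡⟨ cong +_ (regroup (2 ^ k) (𝟙 (c · x Bool.≟ t)) (𝟙 (syndrome C x ≟ᵇ τ))) ⟩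
  + (2 * 𝟙 (c · x Bool.≟ t) * (2 ^ k * 𝟙 (syndrome C x ≟ᵇ τ)))
    ≡⟨ ℤ.pos-* (2 * 𝟙 (c · x Bool.≟ t)) _ ⟩
  + (2 * 𝟙 (c · x Bool.≟ t)) ℤ.* + (2 ^ k * 𝟙 (syndrome C x ≟ᵇ τ))
    ≡⟨ cong₂ ℤ._*_ (sym (1+σ*σ (c · x) t)) (indicator-expansion C τ x) ⟩
  (1ℤ ℤ.+ s) ℤ.* ∑ℤ h
    ≡⟨ distrib s (∑ℤ h) ⟩
  ∑ℤ h ℤ.+ s ℤ.* ∑ℤ h
    ≡⟨ cong (ℤ._+_ (∑ℤ h)) (sym (∑ℤ-hom (s ℤ.*_) (ℤ.*-distribˡ-+ s) h)) ⟩
  ∑ℤ h ℤ.+ ∑ℤ (λ I → s ℤ.* h I)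
    ≡⟨ cong (ℤ._+_ (∑ℤ h)) (∑ℤ-cong λ I → sym (h-true I)) ⟩
  ∑ℤ (λ I → σ (I · (t ∷ τ)) ℤ.* σ (combination (c ∷ C) I · x)) ∎
  where
  open ≡-Reasoning
  s : ℤ
  s = σ t ℤ.* σ (c · x)
  h : Bits k → ℤ
  h I = σ (I · τ) ℤ.* σ (combination C I · x)
  regroup : ∀ m a b → 2 * m * (a * b) ≡ 2 * a * (m * b)
  regroup = ℕ-Solver.solve-∀
  distrib : ∀ s S → (1ℤ ℤ.+ s) ℤ.* S ≡ S ℤ.+ s ℤ.* S
  distrib = ℤ-Solver.solve-∀
  interchange : ∀ a b c d → (a ℤ.* b) ℤ.* (c ℤ.* d) ≡ (a ℤ.* c) ℤ.* (b ℤ.* d)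
  interchange = ℤ-Solver.solve-∀
  h-true : ∀ I → σ (t xor I · τ) ℤ.* σ ((c ⊕ combination C I) · x) ≡ s ℤ.* h I
  h-true I = begin
    σ (t xor I · τ) ℤ.* σ ((c ⊕ combination C I) · x)
      ≡⟨ cong₂ ℤ._*_ (σ-xor t (I · τ)) (trans (cong σ (·-distribʳ-⊕ c _ x)) (σ-xor (c · x) _)) ⟩
    (σ t ℤ.* σ (I · τ)) ℤ.* (σ (c · x) ℤ.* σ (combination C I · x))
      ≡⟨ interchange (σ t) (σ (I · τ)) (σ (c · x)) (σ (combination C I · x)) ⟩
    s ℤ.* h I ∎

count-solutions : ∀ {r k} (C : Vec (Bits r) k) → Independent C → ∀ τ →
                  2 ^ k * count (solutions? C τ) ≡ 2 ^ r
count-solutions {r} {k} C C-independent τ = ℤ.+-injective (begin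
  + (2 ^ k * count (solutions? C τ))
    ≡⟨ ℤ.pos-* (2 ^ k) _ ⟩
  + 2 ^ k ℤ.* + ∑ (λ x → 𝟙 (syndrome C x ≟ᵇ τ))
    ≡⟨ cong (ℤ._*_ (+ 2 ^ k)) (sym (∑ℤ-pos λ x → 𝟙 (syndrome C x ≟ᵇ τ))) ⟩
  + 2 ^ k ℤ.* ∑ℤ (λ x → + 𝟙 (syndrome C x ≟ᵇ τ))
    ≡⟨ sym (∑ℤ-hom (ℤ._*_ (+ 2 ^ k)) (ℤ.*-distribˡ-+ (+ 2 ^ k)) λ x → + 𝟙 (syndrome C x ≟ᵇ τ)) ⟩
  ∑ℤ (λ x → + 2 ^ k ℤ.* + 𝟙 (syndrome C x ≟ᵇ τ))
    ≡⟨ ∑ℤ-cong {r} (λ x → trans (sym (ℤ.pos-* (2 ^ k) _)) (indicator-expansion C τ x)) ⟩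
  ∑ℤ (λ x → ∑ℤ (λ I → σ (I · τ) ℤ.* σ (combination C I · x)))
    ≡⟨ ∑ℤ-swap (λ x I → σ (I · τ) ℤ.* σ (combination C I · x)) ⟩
  ∑ℤ (λ I → ∑ℤ (λ x → σ (I · τ) ℤ.* σ (combination C I · x)))
    ≡⟨ ∑ℤ-cong (λ I → ∑ℤ-hom (ℤ._*_ (σ (I · τ))) (ℤ.*-distribˡ-+ (σ (I · τ)))
                              (λ x → σ (combination C I · x))) ⟩
  ∑ℤ (λ I → σ (I · τ) ℤ.* ∑ℤ (λ x → σ (combination C I · x)))
    ≡⟨ ∑ℤ-point 0ᵇ (λ I I≢0ᵇ → trans
         (cong (ℤ._*_ (σ (I · τ))) (character-sum _ (I≢0ᵇ ∘ C-independent I))) (ℤ.*-zeroʳ (σ (I · τ)))) ⟩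
  σ (0ᵇ · τ) ℤ.* ∑ℤ (λ x → σ (combination C 0ᵇ · x))
    ≡⟨ cong₂ ℤ._*_ (cong σ (·-zeroˡ τ))
                   (trans (∑ℤ-cong λ x → cong (λ u → σ (u · x)) (combination-0ᵇ C)) (character-sum-0ᵇ r)) ⟩
  1ℤ ℤ.* + 2 ^ r
    ≡⟨ ℤ.*-identityˡ _ ⟩
  + 2 ^ r ∎)
  where open ≡-Reasoning

-- Whatever the flip F, take the z whose adjacencies to x and v are exactly the ones F inverts:
-- then x–z–v is a path of the flipped graph.
allPatterns⇒inBall₂ : ∀ {n} (G : Graph n) (q : Partition n) (ℓ x v : Fin n) →
  (∀ α β → ∃ λ z → q z ≡ ℓ × z ≢ x × z ≢ v × adj G x z ≡ α × adj G z v ≡ β) →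
  InBall G 2 q v x
allPatterns⇒inBall₂ G q ℓ x v patterns (F , _)
  with z , qz≡ℓ , z≢x , z≢v , xz , zv ← patterns (not (F (q x) ℓ)) (not (F ℓ (q v))) =
  step (z≢x ∘ sym , flipped xz (cong (F (q x)) qz≡ℓ))
       (step (z≢v , flipped zv (cong (flip F (q v)) qz≡ℓ)) here)
  where
  flipped : ∀ {a b c} → a ≡ not c → b ≡ c → a xor b ≡ true
  flipped {c = c} refl refl = xor-inverseˡ c

pmw-positive : ∀ {n r w} (G : Graph n) {x y : Fin n} → x ≢ y → PmwAtMost r G w → 1 ≤ w
pmw-positive G x≢y (suc zero , P , _ , singletons , whole , _) = contradiction (singletons _ _ (whole _ _)) x≢y
pmw-positive G {x} x≢y (suc (suc L) , P , _ , _ , _ , _ , balls)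
  with zs , length≤w , covers ← balls 0 (s≤s (s≤s z≤n)) x =
  ℕ.≤-trans (nonempty (covers x λ _ → here)) length≤w
  where
  nonempty : ∀ {z zs} → z ∈ zs → 1 ≤ length zs
  nonempty {zs = _ ∷ _} _ = s≤s z≤n

-- The inner-product pattern

τ-ball τ-centre : Bits 4
τ-ball   = true ∷ true  ∷ false ∷ false ∷ []
τ-centre = true ∷ false ∷ true  ∷ false ∷ []

syndrome-entry : ∀ {r k} (C : Vec (Bits r) k) i {x τ} → syndrome C x ≡ τ → Vec.lookup C i · x ≡ Vec.lookup τ i
syndrome-entry C i {x} Cx≡τ = trans (sym (lookup-map i (_· x) C)) (cong (flip Vec.lookup i) Cx≡τ)

all-pairs : ∀ {r} (C : Vec (Bits r) 4) {y v} → syndrome C y ≡ τ-ball → syndrome C v ≡ τ-centre →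
            ∀ α β → ∃ λ i → Vec.lookup C i · y ≡ α × Vec.lookup C i · v ≡ β
all-pairs C Cy≡ Cv≡ true  true  = 0F , syndrome-entry C 0F Cy≡ , syndrome-entry C 0F Cv≡
all-pairs C Cy≡ Cv≡ true  false = 1F , syndrome-entry C 1F Cy≡ , syndrome-entry C 1F Cv≡
all-pairs C Cy≡ Cv≡ false true  = 2F , syndrome-entry C 2F Cy≡ , syndrome-entry C 2F Cv≡
all-pairs C Cy≡ Cv≡ false false = 3F , syndrome-entry C 3F Cy≡ , syndrome-entry C 3F Cv≡

-- Nine = 2³ + 1 is what independent-vectors needs to find four independent vectors.
Crowded : ∀ {r m} → (Bits r → Fin m) → Partition m → Set
Crowded g p = ∃ λ ℓ → 9 ≤ count (λ u → p (g u) ≟ ℓ)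

crowded? : ∀ {r m} (g : Bits r → Fin m) → Decidable (Crowded g)
crowded? g p = Fin.any? (λ ℓ → 9 ℕ.≤? count (λ u → p (g u) ≟ ℓ))

¬crowded⇒sparse : ∀ {r m} {g : Bits r → Fin m} {p} → ¬ Crowded g p → ∀ ℓ → count (λ u → p (g u) ≟ ℓ) ≤ 8
¬crowded⇒sparse ¬crowded ℓ = ℕ.≤-pred (ℕ.≰⇒> (¬crowded ∘ (ℓ ,_)))

singletons-uncrowded : ∀ {r m} {g : Bits r → Fin m} {p} → Injective _≡_ _≡_ g → Singletons p → ¬ Crowded g p
singletons-uncrowded {g = g} {p} g-injective singletons (ℓ , 9≤) =
  ℕ.<⇒≱ (ℕ.<-≤-trans (s≤s (s≤s z≤n)) 9≤) (count-fibre≤1 (p ∘ g) (g-injective ∘ singletons _ _) ℓ)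

whole-crowded : ∀ {r m} {g : Bits r → Fin m} {p} → 9 ≤ 2 ^ r → Whole p → Crowded g p
whole-crowded {r} {g = g} {p} 9≤2^r whole = p (g 0ᵇ) , ℕ.≤-trans 9≤2^r (ℕ.≤-reflexive (sym (begin
  count (λ u → p (g u) ≟ p (g 0ᵇ))  ≡⟨ ∑-cong (λ u → 𝟙-yes (p (g u) ≟ p (g 0ᵇ)) (whole _ _)) ⟩
  ∑ {r} (λ _ → 1)                   ≡⟨ ∑-one r ⟩
  2 ^ r                             ∎)))
  where open ≡-Reasoning

module InnerProductPattern {m r} (H : Graph m) (X Z : Bits r → Fin m) (X-injective : Injective _≡_ _≡_ X)
                           (adj-XZ : ∀ y c → adj H (X y) (Z c) ≡ c · y) where

  Z[_] : ∀ {k} → Vec (Bits r) k → List (Fin m)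
  Z[ C ] = Vec.toList (Vec.map Z C)

  hits? : ∀ {k} (C : Vec (Bits r) k) → Decidable (λ y → X y ∈ Z[ C ])
  hits? C y = any? (X y ≟_) Z[ C ]

  count-hits≤ : ∀ {k} (C : Vec (Bits r) k) → count (hits? C) ≤ k
  count-hits≤ C = ℕ.≤-trans (count-preimage≤ X X-injective Z[ C ]) (ℕ.≤-reflexive (length-toList (Vec.map Z C)))

  solutions-in-ball : (q : Partition m) (ℓ : Fin m) (C : Vec (Bits r) 4) → All (λ c → q (Z c) ≡ ℓ) C →
                      ∀ {y v} → syndrome C y ≡ τ-ball → X y ∉ Z[ C ] →
                      syndrome C v ≡ τ-centre → X v ∉ Z[ C ] → InBall H 2 q (X v) (X y)
  solutions-in-ball q ℓ C C⊆ℓ {y} {v} Cy≡ y∉ Cv≡ v∉ = allPatterns⇒inBall₂ H q ℓ (X y) (X v) λ α β →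
    let i , ci·y , ci·v = all-pairs C Cy≡ Cv≡ α β
        Zci∈ = VecMembership.∈-toList⁺ (VecMembership.∈-map⁺ Z (VecMembership.∈-lookup i C))
    in Z (Vec.lookup C i) , lookup⁺ C⊆ℓ i
     , (λ e → y∉ (subst (_∈ Z[ C ]) e Zci∈)) , (λ e → v∉ (subst (_∈ Z[ C ]) e Zci∈))
     , trans (adj-XZ y _) ci·y , trans (Graph.sym H _ (X v)) (trans (adj-XZ v _) ci·v)

  module _ (q p : Partition m) (w : ℕ) (balls : ∀ v → BallPartsAtMost H 2 q p v w)
           (uncrowded : ¬ Crowded X p) where

    independent-ball-bound : (ℓ : Fin m) (C : Vec (Bits r) 4) → All (λ c → q (Z c) ≡ ℓ) C → Independent C →
                             2 ^ r ≤ 128 * w + 64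
    independent-ball-bound ℓ C C⊆ℓ C-independent with 4 ℕ.<? count (solutions? C τ-centre)
    ... | no N≤4 = begin
      2 ^ r                               ≡⟨ count-solutions C C-independent τ-centre ⟨
      16 * count (solutions? C τ-centre)  ≤⟨ ℕ.*-monoʳ-≤ 16 (ℕ.≮⇒≥ N≤4) ⟩
      64                                  ≤⟨ ℕ.m≤n+m 64 (128 * w) ⟩
      128 * w + 64                        ∎
      where open ℕ.≤-Reasoning
    ... | yes 4<N
      with v , Cv≡ , v∉ ← count<⇒∃ (solutions? C τ-centre) (hits? C) (ℕ.≤-<-trans (count-hits≤ C) 4<N)
      with zs , length≤w , covers ← balls (X v) = begin
      2 ^ r                                 ≡⟨ count-solutions C C-independent τ-ball ⟨
      16 * count (solutions? C τ-ball)      ≤⟨ ℕ.*-monoʳ-≤ 16 (count-split (solutions? C τ-ball) (hits? C)) ⟩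
      16 * (count (hits? C) + count good?)  ≤⟨ ℕ.*-monoʳ-≤ 16 (ℕ.+-mono-≤ (count-hits≤ C) good≤8w) ⟩
      16 * (4 + w * 8)                      ≡⟨ arithmetic w ⟩
      128 * w + 64                          ∎
      where
      open ℕ.≤-Reasoning
      good? : Decidable (λ y → syndrome C y ≡ τ-ball × X y ∉ Z[ C ])
      good? y = solutions? C τ-ball y ×-dec ¬? (hits? C y)
      good≤8w : count good? ≤ w * 8
      good≤8w = ℕ.≤-trans
        (pigeonhole (p ∘ X) (¬crowded⇒sparse {g = X} {p} uncrowded) zs good? λ (Cy≡ , y∉) →
          covers _ (solutions-in-ball q ℓ C C⊆ℓ Cy≡ y∉ Cv≡ v∉))
        (ℕ.*-monoˡ-≤ 8 length≤w)
      arithmetic : ∀ w → 16 * (4 + w * 8) ≡ 128 * w + 64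
      arithmetic = ℕ-Solver.solve-∀

    ball-bound : Crowded Z q → 2 ^ r ≤ 128 * w + 64
    ball-bound (ℓ , 9≤) =
      let C , C⊆ℓ , C-independent = independent-vectors (λ c → q (Z c) ≟ ℓ) 3 9≤
      in independent-ball-bound ℓ C C⊆ℓ C-independent

first-crossing : ∀ {b} {B : Pred ℕ b} → Decidable B → ¬ B 0 → ∀ n → B n →
                 ∃ λ i → i < n × ¬ B i × B (suc i)
first-crossing B? ¬B0 zero    B0   = contradiction B0 ¬B0
first-crossing B? ¬B0 (suc n) Bn+1 with B? n
... | yes Bn  with i , i<n , ¬Bi , Bi+1 ← first-crossing B? ¬B0 n Bn = i , ℕ.m<n⇒m<1+n i<n , ¬Bi , Bi+1
... | no  ¬Bn = n , ℕ.n<1+n n , ¬Bn , Bn+1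

module InnerProductGraph {m r} (H : Graph m) (a b : Bits r → Fin m)
  (a-injective : Injective _≡_ _≡_ a) (b-injective : Injective _≡_ _≡_ b)
  (adj-ba : ∀ v u → adj H (b v) (a u) ≡ u · v) (9≤2^r : 9 ≤ 2 ^ r) where

  adj-ab : ∀ u v → adj H (a u) (b v) ≡ v · u
  adj-ab u v = trans (Graph.sym H (a u) (b v)) (trans (adj-ba v u) (·-comm u v))

  pmw-bound : ∀ w → PmwAtMost 2 H w → 2 ^ r ≤ 128 * w + 64
  pmw-bound w (suc L , P , _ , singletons , whole , _ , balls)
    with i , i<L , ¬crowded , crowded ← first-crossing (λ j → crowded? a (P j) ⊎-dec crowded? b (P j))
           (λ { (inj₁ c) → singletons-uncrowded a-injective singletons c
              ; (inj₂ c) → singletons-uncrowded b-injective singletons c })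
           L (inj₁ (whole-crowded {g = a} 9≤2^r whole))
    with crowded
  ... | inj₁ a-crowded = InnerProductPattern.ball-bound H b a b-injective adj-ba
                           (P (suc i)) (P i) w (balls i (s≤s i<L)) (¬crowded ∘ inj₂) a-crowded
  ... | inj₂ b-crowded = InnerProductPattern.ball-bound H a b a-injective adj-ab
                           (P (suc i)) (P i) w (balls i (s≤s i<L)) (¬crowded ∘ inj₁) b-crowded

lookup-injective : ∀ {A : Set} {xs : List A} → Unique xs → Injective _≡_ _≡_ (List.lookup xs)
lookup-injective {xs = _ ∷ _} (_    ∷ _)         {zero}  {zero}  _ = refl
lookup-injective {xs = _ ∷ _} (x∉xs ∷ _)         {zero}  {suc j} e = contradiction e (lookup x∉xs (∈-lookup j))
lookup-injective {xs = _ ∷ _} (x∉xs ∷ _)         {suc i} {zero}  e = contradiction (sym e) (lookup x∉xs (∈-lookup i))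
lookup-injective {xs = _ ∷ _} (_    ∷ xs-unique) {suc i} {suc j} e = cong suc (lookup-injective xs-unique e)

record Enumeration {n} (L : List (Fin n)) : Set where
  field
    size        : ℕ
    enum        : Fin size → Fin n
    injective   : Injective _≡_ _≡_ enum
    size≤length : size ≤ length L
    locate      : ∀ {x} → x ∈ L → Fin size
    enum-locate : ∀ {x} (x∈L : x ∈ L) → enum (locate x∈L) ≡ x

  locate-injective : ∀ {x y} (x∈L : x ∈ L) (y∈L : y ∈ L) → locate x∈L ≡ locate y∈L → x ≡ y
  locate-injective x∈L y∈L e = trans (sym (enum-locate x∈L)) (trans (cong enum e) (enum-locate y∈L))

deduplicated : ∀ {n} (L : List (Fin n)) → Enumeration L
deduplicated {n} L = record
  { size        = length D
  ; enum        = List.lookup D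
  ; injective   = lookup-injective (UniqueDec.deduplicate-! _≟_ L)
  ; size≤length = length-deduplicate _≟_ L
  ; locate      = λ x∈L → index (∈-deduplicate⁺ _≟_ x∈L)
  ; enum-locate = λ x∈L → sym (lookup-index (∈-deduplicate⁺ _≟_ x∈L))
  }
  where
  D : List (Fin n)
  D = deduplicate _≟_ L

elements : ∀ {n} → Subset n → List (Fin n)
elements []          = []
elements (true ∷ p)  = zero ∷ map suc (elements p)
elements (false ∷ p) = map suc (elements p)

length-elements : ∀ {n} (p : Subset n) → length (elements p) ≡ ∣ p ∣
length-elements []          = refl
length-elements (true ∷ p)  = cong suc (trans (length-map _ (elements p)) (length-elements p))
length-elements (false ∷ p) = trans (length-map _ (elements p)) (length-elements p)

elements-unique : ∀ {n} (p : Subset n) → Unique (elements p)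
elements-unique []          = []
elements-unique (true ∷ p)  =
  All.map⁺ (universal (λ _ ()) (elements p)) ∷ Unique.map⁺ Fin.suc-injective (elements-unique p)
elements-unique (false ∷ p) = Unique.map⁺ Fin.suc-injective (elements-unique p)

elements⊆ : ∀ {n} (p : Subset n) {x} → x ∈ elements p → x ∈ˢ p
elements⊆ (true ∷ p)  (here refl) = Vec.here
elements⊆ (true ∷ p)  (there x∈)  with y , y∈ , refl ← ∈-map⁻ suc x∈ = Vec.there (elements⊆ p y∈)
elements⊆ (false ∷ p) x∈          with y , y∈ , refl ← ∈-map⁻ suc x∈ = Vec.there (elements⊆ p y∈)

nonempty : ∀ {n} (p : Subset n) → 1 ≤ ∣ p ∣ → Nonempty p
nonempty {n} p 1≤∣p∣ with nonempty? p
... | yes p≢∅ = p≢∅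
... | no  p≡∅ = contradiction (subst (λ q → 1 ≤ ∣ q ∣) (Empty-unique p≡∅) 1≤∣p∣) λ 1≤∣⊥∣ →
  ℕ.<⇒≢ 1≤∣⊥∣ (sym (∣⊥∣≡0 n))

subset : ∀ {n p} {P : Pred (Fin n) p} → Decidable P → Subset n
subset P? = Vec.tabulate (does ∘ P?)

∈-subset⁺ : ∀ {n p} {P : Pred (Fin n) p} (P? : Decidable P) {x} → P x → x ∈ˢ subset P?
∈-subset⁺ P? {x} Px = lookup⇒[]= x _ (trans (lookup∘tabulate (does ∘ P?) x) (dec-true (P? x) Px))

∈-subset⁻ : ∀ {n p} {P : Pred (Fin n) p} (P? : Decidable P) {x} → x ∈ˢ subset P? → P x
∈-subset⁻ P? {x} x∈ with P? x | trans (sym (lookup∘tabulate (does ∘ P?) x)) ([]=⇒lookup x∈)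
... | yes Px | _  = Px
... | no _   | ()

module ShatteredCube {n r} (G : Graph n) (A : Subset n) (A-shattered : Shattered G A)
                     (2^r≤∣A∣ : 2 ^ r ≤ ∣ A ∣) where

  a : Bits r → Fin n
  a u = List.lookup (elements A) (Fin.inject≤ (index (∈-cube u)) cube≤A)
    where
    cube≤A : length (cube r) ≤ length (elements A)
    cube≤A = subst₂ _≤_ (sym (length-cube r)) (sym (length-elements A)) 2^r≤∣A∣

  a-injective : Injective _≡_ _≡_ a
  a-injective {u} {v} e = SetoidMembership.index-injective (setoid (Bits r)) (∈-cube u) (∈-cube v)
    (Fin.inject≤-injective _ _ _ _ (lookup-injective (elements-unique A) e))

  a∈A : ∀ u → a u ∈ˢ A
  a∈A u = elements⊆ A (∈-lookup _)

  target? : ∀ v → Decidable (λ x → ∃ λ u → a u ≡ x × u · v ≡ true)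
  target? v x = ∃? λ u → (a u ≟ x) ×-dec (u · v Bool.≟ true)

  targets : Bits r → Subset n
  targets v = subset (target? v)

  targets⊆A : ∀ v → targets v ⊆ˢ A
  targets⊆A v x∈ with u , refl , _ ← ∈-subset⁻ (target? v) x∈ = a∈A u

  b : Bits r → Fin n
  b v = proj₁ (A-shattered (targets v) (targets⊆A v))

  adj-ba : ∀ v u → adj G (b v) (a u) ≡ u · v
  adj-ba v u = ⇔→≡ (mk⇔ adjacent⇒ ⇒adjacent)
    where
    shatters : (adj G (b v) (a u) ≡ true → a u ∈ˢ targets v) × (a u ∈ˢ targets v → adj G (b v) (a u) ≡ true)
    shatters = proj₂ (A-shattered (targets v) (targets⊆A v)) (a u) (a∈A u)
    adjacent⇒ : adj G (b v) (a u) ≡ true → u · v ≡ true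
    adjacent⇒ adjacent with t , at≡au , t·v ← ∈-subset⁻ (target? v) (proj₁ shatters adjacent) =
      subst (λ x → x · v ≡ true) (a-injective at≡au) t·v
    ⇒adjacent : u · v ≡ true → adj G (b v) (a u) ≡ true
    ⇒adjacent u·v = proj₂ shatters (∈-subset⁺ (target? v) (u , refl , u·v))

  b-injective : Injective _≡_ _≡_ b
  b-injective {v} {w} e = ·-separates v w λ u →
    trans (sym (adj-ba v u)) (trans (cong (λ x → adj G x (a u)) e) (adj-ba w u))

  vertices : List (Fin n)
  vertices = map a (cube r) ++ map b (cube r)

  open Enumeration (deduplicated vertices) public

  H : Graph size
  H = induced G enum

  aᴴ bᴴ : Bits r → Fin size
  aᴴ u = locate (∈-++⁺ˡ (∈-map⁺ a (∈-cube u)))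
  bᴴ v = locate (∈-++⁺ʳ (map a (cube r)) (∈-map⁺ b (∈-cube v)))

  size≤ : size ≤ 2 * 2 ^ r
  size≤ = ℕ.≤-trans size≤length (ℕ.≤-reflexive (begin
    length (map a (cube r) ++ map b (cube r))          ≡⟨ length-++ (map a (cube r)) ⟩
    length (map a (cube r)) + length (map b (cube r))  ≡⟨ cong₂ _+_ (length-map a (cube r)) (length-map b (cube r)) ⟩
    length (cube r) + length (cube r)                  ≡⟨ cong (λ k → k + k) (length-cube r) ⟩
    2 ^ r + 2 ^ r                                      ≡⟨ cong (_+_ (2 ^ r)) (ℕ.+-identityʳ (2 ^ r)) ⟨
    2 * 2 ^ r                                          ∎))
    where open ≡-Reasoning

  pmw-bound : 9 ≤ 2 ^ r → ∀ w → PmwAtMost 2 H w → 2 ^ r ≤ 128 * w + 64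
  pmw-bound = InnerProductGraph.pmw-bound H aᴴ bᴴ
    (λ e → a-injective (locate-injective _ _ e)) (λ e → b-injective (locate-injective _ _ e))
    (λ v u → trans (cong₂ (adj G) (enum-locate _) (enum-locate _)) (adj-ba v u))

BoundedInducedSubgraph : ∀ {n} → Graph n → ℕ → (ℕ → Set) → Set
BoundedInducedSubgraph {n} G s B = Σ ℕ λ m → Σ (Fin m → Fin n) λ f →
  Injective _≡_ _≡_ f × m ≤ s × (∀ w → PmwAtMost 2 (induced G f) w → B w)

weaken : ∀ {n s t} {G : Graph n} {B C : ℕ → Set} → s ≤ t → (∀ {w} → B w → C w) →
         BoundedInducedSubgraph G s B → BoundedInducedSubgraph G t C
weaken s≤t B⇒C (m , f , f-injective , m≤s , bound) =
  m , f , f-injective , ℕ.≤-trans m≤s s≤t , λ w → B⇒C ∘ bound w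

inner-product-subgraph : ∀ {n} r (G : Graph n) (A : Subset n) → Shattered G A → 2 ^ r ≤ ∣ A ∣ → 9 ≤ 2 ^ r →
                         BoundedInducedSubgraph G (2 * 2 ^ r) (λ w → 2 ^ r ≤ 128 * w + 64)
inner-product-subgraph r G A A-shattered 2^r≤∣A∣ 9≤2^r = size , enum , injective , size≤ , pmw-bound 9≤2^r
  where open ShatteredCube {r = r} G A A-shattered 2^r≤∣A∣

edge-subgraph : ∀ {n} (G : Graph n) (A : Subset n) → Shattered G A → 1 ≤ ∣ A ∣ →
                BoundedInducedSubgraph G 2 (1 ≤_)
edge-subgraph G A A-shattered 1≤∣A∣
  with x , x∈A ← nonempty A 1≤∣A∣
  with v , sees ← A-shattered A (λ y∈A → y∈A) =
  size , enum , injective , size≤length ,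
  λ w → pmw-positive (induced G enum) (v≢x ∘ sym ∘ locate-injective x∈ v∈)
  where
  open Enumeration (deduplicated (x ∷ v ∷ []))
  x∈ : x ∈ x ∷ v ∷ []
  x∈ = here refl
  v∈ : v ∈ x ∷ v ∷ []
  v∈ = there (here refl)
  v≢x : v ≢ x
  v≢x refl = contradiction (trans (sym (proj₂ (sees x x∈A) x∈A)) (irrefl G x)) λ ()

binary-magnitude : ∀ k → ∃ λ r → 2 ^ r ≤ suc k × suc k < 2 * 2 ^ r
binary-magnitude zero = 0 , ℕ.≤-refl , s≤s (s≤s z≤n)
binary-magnitude (suc k)
  with r , lower , upper ← binary-magnitude k
  with suc (suc k) ℕ.<? 2 * 2 ^ r
... | yes upper+1 = r , ℕ.m≤n⇒m≤1+n lower , upper+1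
... | no ¬upper+1 = suc r , ℕ.≤-reflexive (sym k+2≡2^r+1) , subst (_< 2 * 2 ^ suc r) (sym k+2≡2^r+1) 2^r+1<2*2^r+1
  where
  k+2≡2^r+1 : suc (suc k) ≡ 2 ^ suc r
  k+2≡2^r+1 = ℕ.≤-antisym upper (ℕ.≮⇒≥ ¬upper+1)
  2^r+1<2*2^r+1 : 2 ^ suc r < 2 * 2 ^ suc r
  2^r+1<2*2^r+1 = ℕ.m<m+n (2 ^ suc r) (ℕ.≤-trans (ℕ.m^n>0 2 (suc r)) (ℕ.m≤m+n _ 0))

384-bound : ∀ {d x} w → d < 2 * x → 128 ≤ x → x ≤ 128 * w + 64 → d ≤ 384 * w
384-bound zero    _    128≤x x≤64 = contradiction (ℕ.≤-trans 128≤x x≤64) (ℕ.<⇒≱ (ℕ.m≤m+n 65 63))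
384-bound {d} {x} (suc w) d<2x _ x≤ = begin
  d                       ≤⟨ ℕ.<⇒≤ d<2x ⟩
  2 * x                   ≤⟨ ℕ.*-monoʳ-≤ 2 x≤ ⟩
  2 * (128 * suc w + 64)  ≡⟨ expand w ⟩
  256 * w + 384           ≤⟨ ℕ.+-monoˡ-≤ 384 (ℕ.*-monoˡ-≤ w (ℕ.m≤m+n 256 128)) ⟩
  384 * w + 384           ≡⟨ collect w ⟩
  384 * suc w             ∎
  where
  open ℕ.≤-Reasoning
  expand : ∀ w → 2 * (128 * suc w + 64) ≡ 256 * w + 384
  expand = ℕ-Solver.solve-∀
  collect : ∀ w → 384 * w + 384 ≡ 384 * suc w
  collect = ℕ-Solver.solve-∀

lemma7p1 : Σ ℕ λ k → (1 ≤ k) ×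
    (∀ (d n : ℕ) (G : Graph n) → VCdimAtLeast G d →
      Σ ℕ λ m → Σ (Fin m → Fin n) λ f →
        Injective _≡_ _≡_ f × (m ≤ 2 * d) ×
        (∀ w → PmwAtMost 2 (induced G f) w → d ≤ k * w))
lemma7p1 = 384 , s≤s z≤n , λ d n G (A , d≤∣A∣ , A-shattered) → subgraph d G A d≤∣A∣ A-shattered
  where
  subgraph : ∀ d {n} (G : Graph n) A → d ≤ ∣ A ∣ → Shattered G A →
             BoundedInducedSubgraph G (2 * d) (λ w → d ≤ 384 * w)
  subgraph zero G A _ _ = 0 , (λ ()) , (λ { {()} }) , z≤n , λ _ _ → z≤n
  subgraph (suc k) G A d≤∣A∣ A-shattered with suc k ℕ.<? 256
  ... | yes d<256 =
    weaken {G = G} (ℕ.*-monoʳ-≤ 2 (s≤s z≤n))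
      (ℕ.≤-trans (ℕ.<⇒≤ (ℕ.<-≤-trans d<256 256≤384)) ∘ ℕ.*-monoʳ-≤ 384)
      (edge-subgraph G A A-shattered (ℕ.≤-trans (s≤s z≤n) d≤∣A∣))
    where
    256≤384 : 256 ≤ 384
    256≤384 = ℕ.m≤m+n 256 128
  ... | no  d≮256
    with r , 2^r≤d , d<2^r+1 ← binary-magnitude k =
    weaken {G = G} (ℕ.*-monoʳ-≤ 2 2^r≤d) (λ {w} → 384-bound w d<2^r+1 128≤2^r)
      (inner-product-subgraph r G A A-shattered (ℕ.≤-trans 2^r≤d d≤∣A∣) (ℕ.≤-trans 9≤128 128≤2^r))
    where
    128≤2^r : 128 ≤ 2 ^ r
    128≤2^r = ℕ.<⇒≤ (ℕ.*-cancelˡ-< 2 128 (2 ^ r) (ℕ.≤-<-trans (ℕ.≮⇒≥ d≮256) d<2^r+1))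
    9≤128 : 9 ≤ 128
    9≤128 = ℕ.m≤m+n 9 119
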